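{- Let $q,r\ge0$ and $n\ge0$ be integers. The number of $(q,r)$-blooming trees on $n+1$ labeled nodes (labels $0,1,\dots,n$) is $\prod_{i=0}^{n-1}\bigl(q+1+(r+2)i\bigr)$.
   Context: An increasing ordered tree on label set $\{0,1,\dots,n\}$ is a rooted tree whose nodes are bijectively labeled by $\{0,\dots,n\}$ such that labels increase along every path from the root to a leaf (so the root is $0$), together with a specified total order on the children of each node. A $(q,r)$-blooming tree is an increasing ordered tree to which $q$ extra indistinguishable unlabeled nodes ("blooms") are appended as children of the root and $r$ extra blooms are appended as children of each labeled non-root node, each inserted into the total order of children of its parent; two such trees are the same iff the underlying labeled ordered trees agree and the blooms occupy the same positions in each node's ordered list of children (blooms being indistinguishable). -}

module Defs where

open import Data.Nat using (ℕ; zero; suc; _+_; _*_; _<_)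
open import Data.List using (List; []; _∷_; _++_; upTo; map)
open import Data.Nat.ListAction using (product)
open import Data.Product using (_×_)
open import Data.Unit using (⊤)
open import Relation.Binary.PropositionalEquality using (_≡_)
open import Data.List.Relation.Binary.Permutation.Propositional using (_↭_)

-- A node carries a label and an ordered list of children; each child is
-- either an (unlabeled, indistinguishable) bloom or a labeled subtree.
-- Propositional equality on Tree is exactly the paper's notion of sameness.
mutual
  data Tree : Set where
    node : ℕ → List Child → Tree

  data Child : Set where
    bloom : Child
    sub   : Tree → Child

mutual
  labels : Tree → List ℕ
  labels (node a cs) = a ∷ labelsC cs

  labelsC : List Child → List ℕ
  labelsC []           = []
  labelsC (bloom ∷ cs) = labelsC cs
  labelsC (sub t ∷ cs) = labels t ++ labelsC cs

blooms : List Child → ℕ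
blooms []           = 0
blooms (bloom ∷ cs) = suc (blooms cs)
blooms (sub _ ∷ cs) = blooms cs

mutual
  WF : ℕ → ℕ → Tree → Set
  WF r k (node a cs) = blooms cs ≡ k × WFC r a cs

  WFC : ℕ → ℕ → List Child → Set
  WFC r a []                      = ⊤
  WFC r a (bloom ∷ cs)            = WFC r a cs
  WFC r a (sub (node b ds) ∷ cs)  = a < b × WF r r (node b ds) × WFC r a cs

-- t is a (q,r)-blooming tree on label set {0,…,n}: labels increase along
-- root-to-leaf paths, labels are bijectively {0,…,n} (hence root is 0),
-- the root has q blooms, every labeled non-root node has r blooms.
IsBlooming : ℕ → ℕ → ℕ → Tree → Set
IsBlooming q r n t = WF r q t × (labels t ↭ upTo (suc n))

bloomCount : ℕ → ℕ → ℕ → ℕ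
bloomCount q r n = product (map (λ i → q + 1 + (r + 2) * i) (upTo n))

-- Deleting the node labelled n + 1 from a (q,r)-blooming tree on {0,…,n+1} leaves a
-- (q,r)-blooming tree on {0,…,n}: that node is a leaf carrying exactly its r blooms.
-- Conversely such a leaf can be grafted into any position of any list of children of a
-- tree on {0,…,n}. A node with k children offers k + 1 positions, so there are
-- (n + q + r n) + (n + 1) = q + 1 + (r + 2) n positions in all, and grafting into
-- different positions of different trees gives different trees.
module Submission where

open import Data.Nat using (ℕ; zero; suc; _+_; _*_; _<_; _≤_; s≤s⁻¹)
open import Data.Nat.Properties using (_≟_; <-trans; <⇒≱; <-irrefl; 1+n≢n; suc-injective; *-zeroʳ; *-identityʳ; n<1+n)
open import Data.Nat.Tactic.RingSolver using (solve-∀)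
open import Data.Nat.ListAction using (product)
open import Data.Nat.ListAction.Properties using (product-++)
open import Data.List using (List; []; _∷_; _++_; length; map; upTo; replicate; concatMap)
open import Data.List.Properties using (length-++; length-map; applyUpTo-∷ʳ; map-++; length-applyUpTo; ∷-injectiveˡ; ∷-injectiveʳ)
open import Data.List.Relation.Unary.All as All using (All; []; _∷_)
open import Data.List.Relation.Unary.All.Properties using (++⁺; ++⁻ˡ; ++⁻ʳ)
open import Data.List.Relation.Unary.Any using (here; there)
open import Data.List.Relation.Unary.AllPairs using ([]; _∷_)
open import Data.List.Relation.Unary.Unique.Propositional using (Unique)
open import Data.List.Relation.Unary.Unique.Propositional.Properties as Unique using ()
open import Data.List.Relation.Binary.Disjoint.Propositional using (Disjoint)
open import Data.List.Membership.Propositional using (_∈_; find; lose)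
open import Data.List.Membership.Propositional.Properties
  using (∈-map⁺; ∈-map⁻; ∈-++⁺ˡ; ∈-++⁺ʳ; ∈-++⁻; ∈-upTo⁺; ∈-upTo⁻; ∈-concatMap⁺; ∈-concatMap⁻)
open import Data.List.Relation.Binary.Permutation.Propositional
  using (_↭_; ↭-refl; ↭-sym; ↭-trans; ↭-prep; ↭-swap; ↭-reflexive; module PermutationReasoning)
open import Data.List.Relation.Binary.Permutation.Propositional.Properties
  using (All-resp-↭; ∈-resp-↭; ++⁺ˡ; ++⁺ʳ; shift; drop-∷; ∷↭∷ʳ; ↭-length; ↭-singleton-inv)
open import Data.Product using (Σ; _×_; _,_; proj₂)
open import Data.Sum using (inj₁; inj₂)
open import Data.Unit using (tt)
open import Data.Empty using (⊥-elim)
open import Relation.Nullary using (¬_; yes; no)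
open import Relation.Binary.PropositionalEquality using (_≡_; _≢_; refl; sym; trans; cong; cong₂; module ≡-Reasoning)
open import Function.Bundles using (_⇔_; mk⇔; Equivalence)
open import Defs

module _ {A B : Set} (f : A → List B) where

  concatMap-unique : ∀ {xs} (g : B → A) →
    All (λ x → Unique (f x) × (∀ {y} → y ∈ f x → g y ≡ x)) xs →
    Unique xs → Unique (concatMap f xs)
  concatMap-unique g [] [] = []
  concatMap-unique {x ∷ xs} g ((fx! , g∘f≡) ∷ ps) (x∉xs ∷ xs!) =
    Unique.++⁺ fx! (concatMap-unique g ps xs!) disjoint
    where
    disjoint : Disjoint (f x) (concatMap f xs)
    disjoint (y∈fx , y∈rest) with find (∈-concatMap⁻ f y∈rest)
    ... | x′ , x′∈xs , y∈fx′ =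
      All.lookup x∉xs x′∈xs (trans (sym (g∘f≡ y∈fx)) (proj₂ (All.lookup ps x′∈xs) y∈fx′))

  length-concatMap-const : ∀ {xs c} → All (λ x → length (f x) ≡ c) xs →
    length (concatMap f xs) ≡ length xs * c
  length-concatMap-const [] = refl
  length-concatMap-const {x ∷ xs} (e ∷ es) = begin
    length (f x ++ concatMap f xs)          ≡⟨ length-++ (f x) ⟩
    length (f x) + length (concatMap f xs)  ≡⟨ cong₂ _+_ e (length-concatMap-const es) ⟩
    _ + length xs * _                       ∎
    where open ≡-Reasoning

upTo-suc↭ : ∀ n → upTo (suc n) ↭ n ∷ upTo n
upTo-suc↭ n = ↭-trans (↭-reflexive (sym (applyUpTo-∷ʳ (λ x → x) n))) (↭-sym (∷↭∷ʳ n (upTo n)))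

bloomCount-suc : ∀ q r n → bloomCount q r (suc n) ≡ bloomCount q r n * (q + 1 + (r + 2) * n)
bloomCount-suc q r n = begin
  product (map factor (upTo (suc n)))             ≡⟨ cong product∘map (sym (applyUpTo-∷ʳ (λ x → x) n)) ⟩
  product (map factor (upTo n ++ n ∷ []))         ≡⟨ cong product (map-++ factor (upTo n) (n ∷ [])) ⟩
  product (map factor (upTo n) ++ factor n ∷ [])  ≡⟨ product-++ (map factor (upTo n)) (factor n ∷ []) ⟩
  bloomCount q r n * (factor n * 1)               ≡⟨ cong (bloomCount q r n *_) (*-identityʳ (factor n)) ⟩
  bloomCount q r n * factor n                     ∎
  where
  open ≡-Reasoning
  factor : ℕ → ℕ
  factor i = q + 1 + (r + 2) * i
  product∘map : List ℕ → ℕ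
  product∘map is = product (map factor is)

labelsC-replicate-bloom : ∀ k → labelsC (replicate k bloom) ≡ []
labelsC-replicate-bloom zero    = refl
labelsC-replicate-bloom (suc k) = labelsC-replicate-bloom k

blooms-replicate-bloom : ∀ k → blooms (replicate k bloom) ≡ k
blooms-replicate-bloom zero    = refl
blooms-replicate-bloom (suc k) = cong suc (blooms-replicate-bloom k)

WFC-replicate-bloom : ∀ r a k → WFC r a (replicate k bloom)
WFC-replicate-bloom r a zero    = tt
WFC-replicate-bloom r a (suc k) = WFC-replicate-bloom r a k

labelsC≡[]⇒≡replicate-bloom : ∀ cs → labelsC cs ≡ [] → cs ≡ replicate (blooms cs) bloom
labelsC≡[]⇒≡replicate-bloom []                    _  = refl
labelsC≡[]⇒≡replicate-bloom (bloom ∷ cs)          eq = cong (bloom ∷_) (labelsC≡[]⇒≡replicate-bloom cs eq)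
labelsC≡[]⇒≡replicate-bloom (sub (node _ _) ∷ cs) ()

All-labelsC-tail : ∀ {P : ℕ → Set} c {cs} → All P (labelsC (c ∷ cs)) → All P (labelsC cs)
All-labelsC-tail bloom   ps = ps
All-labelsC-tail (sub t) ps = ++⁻ʳ (labels t) ps

WFC⇒labelsC-above : ∀ r a cs → WFC r a cs → All (a <_) (labelsC cs)
WFC⇒labelsC-above r a []                     _                   = []
WFC⇒labelsC-above r a (bloom ∷ cs)           w                   = WFC⇒labelsC-above r a cs w
WFC⇒labelsC-above r a (sub (node b ds) ∷ cs) (a<b , (_ , wb) , w) =
  a<b ∷ ++⁺ (All.map (<-trans a<b) (WFC⇒labelsC-above r b ds wb)) (WFC⇒labelsC-above r a cs w)

WF-maximal⇒blooms-only : ∀ {r k b ds} → WF r k (node b ds) → All (_≤ b) (labelsC ds) →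
  ds ≡ replicate k bloom
WF-maximal⇒blooms-only {r} {b = b} {ds} (refl , w) ≤b =
  labelsC≡[]⇒≡replicate-bloom ds (empty (labelsC ds) (WFC⇒labelsC-above r b ds w) ≤b)
  where
  empty : ∀ xs → All (b <_) xs → All (_≤ b) xs → xs ≡ []
  empty []      _         _         = refl
  empty (_ ∷ _) (b<x ∷ _) (x≤b ∷ _) = ⊥-elim (<⇒≱ b<x x≤b)

module LeafGrafting (r m : ℕ) where

  leaf : Tree
  leaf = node m (replicate r bloom)

  data Graft : List Child → List Child → Set where
    front : ∀ {cs} → Graft cs (sub leaf ∷ cs)
    skip  : ∀ {cs xs} c → Graft cs xs → Graft (c ∷ cs) (c ∷ xs)
    into  : ∀ {b ds ys cs} → Graft ds ys → Graft (sub (node b ds) ∷ cs) (sub (node b ys) ∷ cs)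

  mutual
    grafts : List Child → List (List Child)
    grafts []       = (sub leaf ∷ []) ∷ []
    grafts (c ∷ cs) = (sub leaf ∷ c ∷ cs) ∷ graftsInto c cs ++ map (c ∷_) (grafts cs)

    graftsInto : Child → List Child → List (List Child)
    graftsInto bloom             cs = []
    graftsInto (sub (node b ds)) cs = map (λ ys → sub (node b ys) ∷ cs) (grafts ds)

  treeGrafts : Tree → List Tree
  treeGrafts (node a cs) = map (node a) (grafts cs)

  ∈-grafts⁺ : ∀ {cs xs} → Graft cs xs → xs ∈ grafts cs
  ∈-grafts⁺ {[]}    front    = here refl
  ∈-grafts⁺ {_ ∷ _} front    = here refl
  ∈-grafts⁺ (skip c g)       = there (∈-++⁺ʳ (graftsInto c _) (∈-map⁺ (c ∷_) (∈-grafts⁺ g)))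
  ∈-grafts⁺ (into g)         = there (∈-++⁺ˡ (∈-map⁺ _ (∈-grafts⁺ g)))

  mutual
    ∈-grafts⁻ : ∀ {cs xs} → xs ∈ grafts cs → Graft cs xs
    ∈-grafts⁻ {[]}     (here refl) = front
    ∈-grafts⁻ {c ∷ cs} (here refl) = front
    ∈-grafts⁻ {c ∷ cs} (there p) with ∈-++⁻ (graftsInto c cs) p
    ... | inj₁ p₁ = ∈-graftsInto⁻ c p₁
    ... | inj₂ p₂ with ∈-map⁻ (c ∷_) p₂
    ...   | _ , p₃ , refl = skip c (∈-grafts⁻ p₃)

    ∈-graftsInto⁻ : ∀ c {cs xs} → xs ∈ graftsInto c cs → Graft (c ∷ cs) xs
    ∈-graftsInto⁻ (sub (node b ds)) p with ∈-map⁻ _ p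
    ... | _ , p′ , refl = into (∈-grafts⁻ p′)

  Graft-labelsC : ∀ {cs xs} → Graft cs xs → labelsC xs ↭ m ∷ labelsC cs
  Graft-labelsC {cs} front =
    ↭-reflexive (cong (λ ls → m ∷ ls ++ labelsC cs) (labelsC-replicate-bloom r))
  Graft-labelsC (skip bloom g) = Graft-labelsC g
  Graft-labelsC {_ ∷ cs} {_ ∷ xs} (skip (sub t) g) =
    ↭-trans (++⁺ˡ (labels t) (Graft-labelsC g)) (shift m (labels t) (labelsC cs))
  Graft-labelsC {sub (node b _) ∷ cs} (into g) =
    ↭-trans (↭-prep b (++⁺ʳ (labelsC cs) (Graft-labelsC g))) (↭-swap b m ↭-refl)

  Graft-irreflexive : ∀ {cs} → ¬ Graft cs cs
  Graft-irreflexive g = 1+n≢n (sym (↭-length (Graft-labelsC g)))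

  Graft-blooms : ∀ {cs xs} → Graft cs xs → blooms xs ≡ blooms cs
  Graft-blooms front            = refl
  Graft-blooms (skip bloom g)   = cong suc (Graft-blooms g)
  Graft-blooms (skip (sub _) g) = Graft-blooms g
  Graft-blooms (into g)         = refl

  Graft-WFC : ∀ {a cs xs} → a < m → All (_< m) (labelsC cs) → WFC r a cs → Graft cs xs →
    WFC r a xs
  Graft-WFC a<m _ w front =
    a<m , (blooms-replicate-bloom r , WFC-replicate-bloom r m r) , w
  Graft-WFC a<m <m w (skip bloom g) = Graft-WFC a<m <m w g
  Graft-WFC a<m (_ ∷ <m) (a<b , wb , w) (skip (sub (node _ ds)) g) =
    a<b , wb , Graft-WFC a<m (++⁻ʳ (labelsC ds) <m) w g
  Graft-WFC a<m (b<m ∷ <m) (a<b , (bl , wb) , w) (into {ds = ds} g) =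
    a<b , (trans (Graft-blooms g) bl , Graft-WFC b<m (++⁻ˡ (labelsC ds) <m) wb g) , w

  graft-preimage : ∀ {a} cs → WFC r a cs → All (_≤ m) (labelsC cs) → m ∈ labelsC cs →
    Σ (List Child) λ ys → Graft ys cs × WFC r a ys
  graft-preimage (bloom ∷ cs) w ≤m m∈ with graft-preimage cs w ≤m m∈
  ... | ys , g , w′ = bloom ∷ ys , skip bloom g , w′
  graft-preimage (sub (node _ ds) ∷ cs) (a<b , wb , w) (_ ∷ ≤m) (here refl)
    with refl ← WF-maximal⇒blooms-only {ds = ds} wb (++⁻ˡ (labelsC ds) ≤m) = cs , front , w
  graft-preimage (sub (node b ds) ∷ cs) (a<b , (bl , wb) , w) (_ ∷ ≤m) (there m∈)
    with ∈-++⁻ (labelsC ds) m∈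
  ... | inj₁ m∈ds with graft-preimage ds wb (++⁻ˡ (labelsC ds) ≤m) m∈ds
  ...   | ys , g , wys =
    sub (node b ys) ∷ cs , into g , a<b , (trans (sym (Graft-blooms g)) bl , wys) , w
  graft-preimage (sub t@(node b ds) ∷ cs) (a<b , wb , w) (_ ∷ ≤m) (there m∈)
      | inj₂ m∈cs with graft-preimage cs w (++⁻ʳ (labelsC ds) ≤m) m∈cs
  ...   | ys , g , wys = sub t ∷ ys , skip (sub t) g , a<b , wb , wys

  pruneC : List Child → List Child
  pruneC []                     = []
  pruneC (bloom ∷ cs)           = bloom ∷ pruneC cs
  pruneC (sub (node b ds) ∷ cs) with b ≟ m
  ... | yes _ = cs
  ... | no _  = sub (node b (pruneC ds)) ∷ pruneC cs

  prune : Tree → Tree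
  prune (node a cs) = node a (pruneC cs)

  pruneC-front : ∀ cs → pruneC (sub leaf ∷ cs) ≡ cs
  pruneC-front cs with m ≟ m
  ... | yes _  = refl
  ... | no m≢m = ⊥-elim (m≢m refl)

  pruneC-below : ∀ {b ds ds′ cs cs′} → b < m → pruneC ds ≡ ds′ → pruneC cs ≡ cs′ →
    pruneC (sub (node b ds) ∷ cs) ≡ sub (node b ds′) ∷ cs′
  pruneC-below {b} b<m refl refl with b ≟ m
  ... | yes refl = ⊥-elim (<-irrefl refl b<m)
  ... | no _     = refl

  pruneC-id : ∀ cs → All (_< m) (labelsC cs) → pruneC cs ≡ cs
  pruneC-id []                     _          = refl
  pruneC-id (bloom ∷ cs)           <m         = cong (bloom ∷_) (pruneC-id cs <m)
  pruneC-id (sub (node b ds) ∷ cs) (b<m ∷ <m) =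
    pruneC-below b<m (pruneC-id ds (++⁻ˡ (labelsC ds) <m)) (pruneC-id cs (++⁻ʳ (labelsC ds) <m))

  pruneC-Graft : ∀ {cs xs} → All (_< m) (labelsC cs) → Graft cs xs → pruneC xs ≡ cs
  pruneC-Graft {cs} _ front = pruneC-front cs
  pruneC-Graft <m (skip bloom g) = cong (bloom ∷_) (pruneC-Graft <m g)
  pruneC-Graft {sub (node b ds) ∷ _} (b<m ∷ <m) (skip _ g) =
    pruneC-below b<m (pruneC-id ds (++⁻ˡ (labelsC ds) <m)) (pruneC-Graft (++⁻ʳ (labelsC ds) <m) g)
  pruneC-Graft {sub (node b ds) ∷ cs} (b<m ∷ <m) (into g) =
    pruneC-below b<m (pruneC-Graft (++⁻ˡ (labelsC ds) <m) g) (pruneC-id cs (++⁻ʳ (labelsC ds) <m))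

  prune-treeGrafts : ∀ {a cs t} → All (_< m) (labelsC cs) → t ∈ treeGrafts (node a cs) →
    prune t ≡ node a cs
  prune-treeGrafts <m t∈ with ∈-map⁻ _ t∈
  ... | _ , xs∈ , refl = cong (node _) (pruneC-Graft <m (∈-grafts⁻ xs∈))

  front≢rest : ∀ c {cs ys} → All (_< m) (labelsC (c ∷ cs)) →
    ys ∈ graftsInto c cs ++ map (c ∷_) (grafts cs) → sub leaf ∷ c ∷ cs ≢ ys
  front≢rest c {cs} <m ys∈ eq with ∈-++⁻ (graftsInto c cs) ys∈
  front≢rest (sub (node _ _)) _ _ eq | inj₁ ys∈ with ∈-map⁻ _ ys∈
  ... | _ , _ , refl = 1+n≢n (cong length (∷-injectiveʳ eq))
  front≢rest c <m _ eq | inj₂ ys∈ with ∈-map⁻ (c ∷_) ys∈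
  ... | _ , _ , refl with refl ← eq = <-irrefl refl (All.head <m)

  into-skip-disjoint : ∀ c {cs} → Disjoint (graftsInto c cs) (map (c ∷_) (grafts cs))
  into-skip-disjoint (sub (node _ _)) (p₁ , p₂) with ∈-map⁻ _ p₁ | ∈-map⁻ _ p₂
  ... | _ , ds∈ , refl | _ , _ , refl = Graft-irreflexive (∈-grafts⁻ ds∈)

  -- Labels below m are needed: were some child already the leaf, grafting in front of it
  -- and right after it would give the same list.
  mutual
    grafts-unique : ∀ cs → All (_< m) (labelsC cs) → Unique (grafts cs)
    grafts-unique []       _  = [] ∷ []
    grafts-unique (c ∷ cs) <m =
      All.tabulate (front≢rest c <m) ∷
      Unique.++⁺ (graftsInto-unique c <m)
                 (Unique.map⁺ ∷-injectiveʳ (grafts-unique cs (All-labelsC-tail c <m)))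
                 (into-skip-disjoint c)

    graftsInto-unique : ∀ c {cs} → All (_< m) (labelsC (c ∷ cs)) → Unique (graftsInto c cs)
    graftsInto-unique bloom             _        = []
    graftsInto-unique (sub (node _ ds)) (_ ∷ <m) =
      Unique.map⁺ (λ { refl → refl }) (grafts-unique ds (++⁻ˡ (labelsC ds) <m))

  treeGrafts-unique : ∀ {a cs} → All (_< m) (labelsC cs) → Unique (treeGrafts (node a cs))
  treeGrafts-unique {cs = cs} <m = Unique.map⁺ (λ { refl → refl }) (grafts-unique cs <m)

  length-grafts : ∀ {a} cs → WFC r a cs →
    length (grafts cs) ≡ suc (blooms cs + (2 + r) * length (labelsC cs))
  length-grafts []           _ = cong suc (sym (*-zeroʳ (2 + r)))
  length-grafts (bloom ∷ cs) w =
    cong suc (trans (length-map (bloom ∷_) (grafts cs)) (length-grafts cs w))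
  length-grafts (sub (node b ds) ∷ cs) (_ , (bl , wb) , w) = cong suc (begin
      length (map _ (grafts ds) ++ map _ (grafts cs))
    ≡⟨ length-++ (map _ (grafts ds)) ⟩
      length (map _ (grafts ds)) + length (map _ (grafts cs))
    ≡⟨ cong₂ _+_ (length-map _ (grafts ds)) (length-map _ (grafts cs)) ⟩
      length (grafts ds) + length (grafts cs)
    ≡⟨ cong₂ _+_ (length-grafts ds wb) (length-grafts cs w) ⟩
      suc (blooms ds + (2 + r) * length (labelsC ds)) + suc (blooms cs + (2 + r) * length (labelsC cs))
    ≡⟨ cong (λ k → suc (k + (2 + r) * length (labelsC ds)) + _) bl ⟩
      suc (r + (2 + r) * length (labelsC ds)) + suc (blooms cs + (2 + r) * length (labelsC cs))
    ≡⟨ regroup r (length (labelsC ds)) (length (labelsC cs)) (blooms cs) ⟩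
      blooms cs + (2 + r) * suc (length (labelsC ds) + length (labelsC cs))
    ≡⟨ cong (λ k → blooms cs + (2 + r) * suc k) (sym (length-++ (labelsC ds))) ⟩
      blooms cs + (2 + r) * length (labelsC (sub (node b ds) ∷ cs))
    ∎)
    where
    open ≡-Reasoning
    regroup : ∀ r x y k → suc (r + (2 + r) * x) + suc (k + (2 + r) * y) ≡ k + (2 + r) * suc (x + y)
    regroup = solve-∀

Enumeration : ℕ → ℕ → ℕ → List Tree → Set
Enumeration q r n L =
  Unique L × ((t : Tree) → (t ∈ L) ⇔ IsBlooming q r n t) × length L ≡ bloomCount q r n

module _ {q r n : ℕ} where

  IsBlooming⇒labels< : ∀ t → IsBlooming q r n t → All (_< suc n) (labels t)
  IsBlooming⇒labels< _ (_ , p) = All-resp-↭ (↭-sym p) (All.tabulate ∈-upTo⁻)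

  IsBlooming⇒root≡0 : ∀ {a} cs → IsBlooming q r n (node a cs) → a ≡ 0
  IsBlooming⇒root≡0 {a} cs ((_ , w) , p) with ∈-resp-↭ (↭-sym p) (here refl)
  ... | here 0≡a  = sym 0≡a
  ... | there 0∈  with () ← All.lookup (WFC⇒labelsC-above r a cs w) 0∈

  IsBlooming⇒length-labelsC : ∀ {a} cs → IsBlooming q r n (node a cs) → length (labelsC cs) ≡ n
  IsBlooming⇒length-labelsC _ (_ , p) =
    suc-injective (trans (↭-length p) (length-applyUpTo (λ x → x) (suc n)))

enumeration-zero : ∀ q r → Enumeration q r 0 (node 0 (replicate q bloom) ∷ [])
enumeration-zero q r = [] ∷ [] , (λ t → mk⇔ blooming (∈-singleton t)) , refl
  where
  blooming : ∀ {t} → t ∈ node 0 (replicate q bloom) ∷ [] → IsBlooming q r 0 t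
  blooming (here refl) =
    (blooms-replicate-bloom q , WFC-replicate-bloom r 0 q) ,
    ↭-reflexive (cong (0 ∷_) (labelsC-replicate-bloom q))
  ∈-singleton : ∀ t → IsBlooming q r 0 t → t ∈ node 0 (replicate q bloom) ∷ []
  ∈-singleton (node a cs) ((refl , _) , p) with ↭-singleton-inv p
  ... | eq with refl ← ∷-injectiveˡ eq =
    here (cong (node 0) (labelsC≡[]⇒≡replicate-bloom cs (∷-injectiveʳ eq)))

module _ {q r n : ℕ} where
  open LeafGrafting r (suc n)

  Graft-IsBlooming : ∀ {a cs xs} → IsBlooming q r n (node a cs) → Graft cs xs →
    IsBlooming q r (suc n) (node a xs)
  Graft-IsBlooming {a} {cs} {xs} bt@((bl , w) , p) g with IsBlooming⇒labels< (node a cs) bt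
  ... | a<m ∷ <m = (trans (Graft-blooms g) bl , Graft-WFC a<m <m w g) , (begin
    a ∷ labelsC xs          ↭⟨ ↭-prep a (Graft-labelsC g) ⟩
    a ∷ suc n ∷ labelsC cs  ↭⟨ ↭-swap a (suc n) ↭-refl ⟩
    suc n ∷ a ∷ labelsC cs  ↭⟨ ↭-prep (suc n) p ⟩
    suc n ∷ upTo (suc n)    ↭⟨ upTo-suc↭ (suc n) ⟨
    upTo (suc (suc n))      ∎)
    where open PermutationReasoning

  IsBlooming⇒Graft : ∀ {a xs} → IsBlooming q r (suc n) (node a xs) →
    Σ (List Child) λ cs → Graft cs xs × IsBlooming q r n (node a cs)
  IsBlooming⇒Graft {a} {xs} bt@((bl , w) , p)
    with refl ← IsBlooming⇒root≡0 xs bt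
    -- n + 1 is not the label 0 of the root, so it labels a proper descendant of the root.
    with ∈-resp-↭ (↭-sym p) (∈-upTo⁺ (n<1+n (suc n)))
  ... | there 1+n∈ with _ ∷ <2+n ← IsBlooming⇒labels< (node 0 xs) bt
    with cs , g , wcs ← graft-preimage xs w (All.map s≤s⁻¹ <2+n) 1+n∈
    = cs , g , (trans (sym (Graft-blooms g)) bl , wcs) , drop-∷ (begin
    suc n ∷ 0 ∷ labelsC cs  ↭⟨ ↭-swap (suc n) 0 ↭-refl ⟩
    0 ∷ suc n ∷ labelsC cs  ↭⟨ ↭-prep 0 (Graft-labelsC g) ⟨
    0 ∷ labelsC xs          ↭⟨ p ⟩
    upTo (suc (suc n))      ↭⟨ upTo-suc↭ (suc n) ⟩
    suc n ∷ upTo (suc n)    ∎)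
    where open PermutationReasoning

  length-treeGrafts : ∀ t → IsBlooming q r n t → length (treeGrafts t) ≡ q + 1 + (r + 2) * n
  length-treeGrafts (node a cs) bt@((bl , w) , _) = begin
      length (map (node a) (grafts cs))
    ≡⟨ length-map (node a) (grafts cs) ⟩
      length (grafts cs)
    ≡⟨ length-grafts cs w ⟩
      suc (blooms cs + (2 + r) * length (labelsC cs))
    ≡⟨ cong₂ (λ k l → suc (k + (2 + r) * l)) bl (IsBlooming⇒length-labelsC cs bt) ⟩
      suc (q + (2 + r) * n)
    ≡⟨ regroup q r n ⟩
      q + 1 + (r + 2) * n
    ∎
    where
    open ≡-Reasoning
    regroup : ∀ q r n → suc (q + (2 + r) * n) ≡ q + 1 + (r + 2) * n
    regroup = solve-∀

  enumeration-suc : ∀ {L} → Enumeration q r n L → Enumeration q r (suc n) (concatMap treeGrafts L)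
  enumeration-suc {L} (L! , ∈L⇔ , |L|≡) = unique , (λ t → mk⇔ sound (complete t)) , length≡
    where
    blooming : ∀ {t} → t ∈ L → IsBlooming q r n t
    blooming = Equivalence.to (∈L⇔ _)

    invertible : ∀ t → IsBlooming q r n t →
      Unique (treeGrafts t) × (∀ {v} → v ∈ treeGrafts t → prune v ≡ t)
    invertible (node a cs) bt with _ ∷ <1+n ← IsBlooming⇒labels< (node a cs) bt =
      treeGrafts-unique <1+n , prune-treeGrafts <1+n

    unique : Unique (concatMap treeGrafts L)
    unique = concatMap-unique treeGrafts prune (All.tabulate (λ t∈ → invertible _ (blooming t∈))) L!

    sound : ∀ {v} → v ∈ concatMap treeGrafts L → IsBlooming q r (suc n) v
    sound v∈ with node a cs , t∈ , v∈′ ← find (∈-concatMap⁻ treeGrafts {xs = L} v∈)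
      with _ , xs∈ , refl ← ∈-map⁻ (node a) v∈′
      = Graft-IsBlooming (blooming t∈) (∈-grafts⁻ xs∈)

    complete : ∀ v → IsBlooming q r (suc n) v → v ∈ concatMap treeGrafts L
    complete (node a xs) bv with cs , g , bt ← IsBlooming⇒Graft bv =
      ∈-concatMap⁺ treeGrafts (lose (Equivalence.from (∈L⇔ _) bt) (∈-map⁺ (node a) (∈-grafts⁺ g)))

    length≡ : length (concatMap treeGrafts L) ≡ bloomCount q r (suc n)
    length≡ = begin
        length (concatMap treeGrafts L)
      ≡⟨ length-concatMap-const treeGrafts (All.tabulate (λ t∈ → length-treeGrafts _ (blooming t∈))) ⟩
        length L * (q + 1 + (r + 2) * n)
      ≡⟨ cong (_* _) |L|≡ ⟩
        bloomCount q r n * (q + 1 + (r + 2) * n)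
      ≡⟨ bloomCount-suc q r n ⟨
        bloomCount q r (suc n)
      ∎
      where open ≡-Reasoning

lemma4p3 : (q r n : ℕ) →
    Σ (List Tree) (λ L →
      Unique L × ((t : Tree) → (t ∈ L) ⇔ IsBlooming q r n t) × length L ≡ bloomCount q r n)
lemma4p3 q r zero    = _ , enumeration-zero q r
lemma4p3 q r (suc n) with L , enum ← lemma4p3 q r n =
  concatMap (LeafGrafting.treeGrafts r (suc n)) L , enumeration-suc enum
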